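{- Let $B$ be a $k$-adjacency basis of a graph $G=(V,E)$, and let $G'=(V,E')$ be any graph on the same vertex set such that $N_{G'}(x)=N_G(x)$ for every $x\in B$. Then $B$ is a $k$-adjacency generator for $G'$, and consequently $\operatorname{adim}_k(G')\le\operatorname{adim}_k(G)$.
   Context: All graphs are finite and simple; $N_G(x)$ is the open neighbourhood of $x$ in $G$. For a graph $G=(V,E)$, $d_{G,2}(x,y)=\min\{d_G(x,y),2\}$ with $d_G$ the shortest-path distance ($\infty$ between different components). For distinct $x,y$, $\mathcal{C}_G(x,y)=\{z\in V: d_{G,2}(x,z)\ne d_{G,2}(y,z)\}$. A set $S\subseteq V$ is a $k$-adjacency generator if $|S\cap\mathcal{C}_G(x,y)|\ge k$ for all distinct $x,y$; a minimum-cardinality one is a $k$-adjacency basis and its size is $\operatorname{adim}_k(G)$. -}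

module Defs where

open import Data.Nat using (ℕ; _≤_; _≡ᵇ_)
open import Data.Bool using (Bool; true; false; not; if_then_else_)
open import Data.Fin using (Fin)
open import Data.Fin.Properties using (_≟_)
open import Data.Fin.Subset using (Subset; _∩_; ∣_∣; _∈_)
open import Data.Vec using (tabulate)
open import Data.Empty using (⊥)
open import Relation.Binary.PropositionalEquality using (_≡_; _≢_)
open import Relation.Nullary using (¬_)
open import Relation.Nullary.Decidable using (⌊_⌋)

record Graph (n : ℕ) : Set where
  field
    adj   : Fin n → Fin n → Bool
    sym   : ∀ x y → adj x y ≡ adj y x
    irrefl : ∀ x → adj x x ≡ false
open Graph public

N : ∀ {n} → Graph n → Fin n → Subset n
N G x = tabulate (adj G x)

-- d_{G,2}(x,y) = min{d_G(x,y), 2}: 0 if x = y, 1 if adjacent, 2 otherwise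
-- (shortest-path distance is ≥ 2, possibly ∞, exactly when x ≠ y non-adjacent).
d₂ : ∀ {n} → Graph n → Fin n → Fin n → ℕ
d₂ G x y = if ⌊ x ≟ y ⌋ then 0 else (if adj G x y then 1 else 2)

𝒞 : ∀ {n} → Graph n → Fin n → Fin n → Subset n
𝒞 G x y = tabulate (λ z → not (d₂ G x z ≡ᵇ d₂ G y z))

IsAdjGenerator : ∀ {n} → Graph n → ℕ → Subset n → Set
IsAdjGenerator G k S = ∀ x y → x ≢ y → k ≤ ∣ S ∩ 𝒞 G x y ∣

IsAdjBasis : ∀ {n} → Graph n → ℕ → Subset n → Set
IsAdjBasis G k B = IsAdjGenerator G k B × (∀ S → IsAdjGenerator G k S → ∣ B ∣ ≤ ∣ S ∣)
  where open import Data.Product using (_×_)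

-- Since adjacency is symmetric, d₂(x,z) depends on z only through N(z). So for
-- every z ∈ B the question "z ∈ 𝒞(x,y)?" has the same answer in G and G', hence
-- B ∩ 𝒞(x,y) is the same set in both graphs and B stays a k-adjacency generator
-- of G'; minimality of any basis of G' then bounds its size by ∣ B ∣.
module Submission where

open import Defs hiding (sym)
open import Data.Nat using (ℕ; _≤_; _≡ᵇ_)
open import Data.Bool using (true; false; not; if_then_else_)
open import Data.Fin.Properties using (_≟_)
open import Data.Fin.Subset using (Subset; ∣_∣; _∈_; _∩_)
open import Data.Product using (_×_; _,_)
open import Data.Vec using (_∷_; []; lookup; here; there)
open import Data.Vec.Properties using (lookup∘tabulate)
open import Function using (_∘_)
open import Relation.Binary.PropositionalEquality using (_≡_; refl; cong; cong₂; subst; sym)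
open Relation.Binary.PropositionalEquality.≡-Reasoning
open import Relation.Nullary.Decidable using (⌊_⌋)

∩-congʳ-on : ∀ {n} (S A C : Subset n) →
  (∀ {i} → i ∈ S → lookup A i ≡ lookup C i) → S ∩ A ≡ S ∩ C
∩-congʳ-on []          []      []      _  = refl
∩-congʳ-on (false ∷ S) (_ ∷ A) (_ ∷ C) eq = cong (false ∷_) (∩-congʳ-on S A C (eq ∘ there))
∩-congʳ-on (true ∷ S)  (_ ∷ A) (_ ∷ C) eq = cong₂ _∷_ (eq here) (∩-congʳ-on S A C (eq ∘ there))

module _ {n} (G G' : Graph n) where

  adj-congʳ : ∀ x {z} → N G' z ≡ N G z → adj G' x z ≡ adj G x z
  adj-congʳ x {z} NG'z≡NGz = begin
    adj G' x z         ≡⟨ Graph.sym G' x z ⟩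
    adj G' z x         ≡⟨ sym (lookup∘tabulate (adj G' z) x) ⟩
    lookup (N G' z) x  ≡⟨ cong (λ v → lookup v x) NG'z≡NGz ⟩
    lookup (N G z) x   ≡⟨ lookup∘tabulate (adj G z) x ⟩
    adj G z x          ≡⟨ Graph.sym G z x ⟩
    adj G x z          ∎

  d₂-congʳ : ∀ x {z} → N G' z ≡ N G z → d₂ G' x z ≡ d₂ G x z
  d₂-congʳ x {z} NG'z≡NGz =
    cong (λ b → if ⌊ x ≟ z ⌋ then 0 else (if b then 1 else 2)) (adj-congʳ x NG'z≡NGz)

  𝒞-congʳ : ∀ x y {z} → N G' z ≡ N G z → lookup (𝒞 G' x y) z ≡ lookup (𝒞 G x y) z
  𝒞-congʳ x y {z} NG'z≡NGz = begin
    lookup (𝒞 G' x y) z               ≡⟨ lookup∘tabulate _ z ⟩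
    not (d₂ G' x z ≡ᵇ d₂ G' y z)      ≡⟨ cong₂ (λ a b → not (a ≡ᵇ b))
                                              (d₂-congʳ x NG'z≡NGz) (d₂-congʳ y NG'z≡NGz) ⟩
    not (d₂ G x z ≡ᵇ d₂ G y z)        ≡⟨ sym (lookup∘tabulate _ z) ⟩
    lookup (𝒞 G x y) z                ∎

  isAdjGenerator-transfer : ∀ {k} {S : Subset n} → (∀ z → z ∈ S → N G' z ≡ N G z) →
    IsAdjGenerator G k S → IsAdjGenerator G' k S
  isAdjGenerator-transfer {k} {S} sameN gen x y x≢y =
    subst (λ T → k ≤ ∣ T ∣)
          (∩-congʳ-on S (𝒞 G x y) (𝒞 G' x y) (λ z∈S → sym (𝒞-congʳ x y (sameN _ z∈S))))
          (gen x y x≢y)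

theorem21 : ∀ {n} (G G' : Graph n) (k : ℕ) (B : Subset n) →
    IsAdjBasis G k B →
    (∀ x → x ∈ B → N G' x ≡ N G x) →
    IsAdjGenerator G' k B × (∀ B' → IsAdjBasis G' k B' → ∣ B' ∣ ≤ ∣ B ∣)
theorem21 G G' k B (B-gen , _) sameN = B-gen' , λ B' (_ , B'-minimal) → B'-minimal B B-gen'
  where
  B-gen' : IsAdjGenerator G' k B
  B-gen' = isAdjGenerator-transfer G G' sameN B-gen
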